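{- Let $f\colon\mathbb{B}^n\to\mathbb{B}^n$ be a Boolean network with set of components $V$, and suppose $V$ is the disjoint union of sets $U_1,U_2,W$ and a vertex $v$ such that the edges of the interaction graph $G(f)$ are only of the following kinds: edges inside $U_1$, inside $U_2$, or inside $W$ (arbitrary); edges from $U_1$ to $U_2$ (possibly none); edges from $U_1$ to $W$ (possibly none); edges from $U_2$ to $v$ (at least one); edges from $v$ to $W$ (at least one); and possibly a loop at $v$, which if present is negative (there is no positive loop at $v$). Then the attractors of $f$ are preserved by the elimination of $v$, that is: (i) for each attractor $A$ of $AD(f)$, $\pi(A)$ is an attractor of $AD(\tilde f)$; and (ii) for each attractor $\tilde A$ of $AD(\tilde f)$ there exists a unique attractor $A$ of $AD(f)$ such that $\pi(A)=\tilde A$.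
   Context: $\mathbb{B}=\{0,1\}$. A Boolean network is a map $f\colon\mathbb{B}^n\to\mathbb{B}^n$ with components $V=\{1,\dots,n\}$. $\bar{x}^i$ denotes $x$ with component $i$ flipped; $x^{i=a}$ denotes $x$ with component $i$ set to $a$. The asynchronous dynamics $AD(f)$ is the directed graph on $\mathbb{B}^n$ with a transition $x\to\bar{x}^i$ iff $f_i(x)\neq x_i$. The interaction graph $G(f)$ is the signed multidigraph on $V$ with an edge $j\to i$ of sign $s\in\{ -1,1\}$ iff $s=(f_i(\bar{x}^j)-f_i(x))(\bar{x}^j_j-x_j)$ for some $x\in\mathbb{B}^n$; a loop is an edge $v\to v$, negative/positive according to its sign. A trap set is a set of states closed under transitions of the asynchronous dynamics; attractors are the minimal nonempty trap sets. Elimination of $v$ (no positive loop at $v$): for $a\in\{0,1\}$, $\mathcal{R}^a(x)=(x_1,\dots,x_{v-1},f_v(x^{v=a}),x_{v+1},\dots,x_n)$; $\pi\colon\mathbb{B}^n\to\mathbb{B}^{n-1}$ is the projection onto components $V\setminus\{v\}$; $\mathcal{S}^a$ is the unique map with $\mathcal{S}^a\circ\pi=\mathcal{R}^a$; $\tilde f\colon\mathbb{B}^{n-1}\to\mathbb{B}^{n-1}$, $\tilde f_i(x)=f_i(\mathcal{S}^0(x))\wedge f_i(\mathcal{S}^1(x))$ if $x_i=1$ and $\tilde f_i(x)=f_i(\mathcal{S}^0(x))\vee f_i(\mathcal{S}^1(x))$ if $x_i=0$, for $i\neq v$. -}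

module Defs where

open import Data.Nat using (ℕ; suc)
open import Data.Fin using (Fin; punchIn)
open import Data.Bool using (Bool; true; false; not; _∧_; _∨_; if_then_else_)
open import Data.Vec using (Vec; lookup; _[_]≔_; insertAt; removeAt)
open import Data.Integer as ℤ using (ℤ; _◃_)
open import Data.Sign using (Sign)
open import Data.Product using (Σ; ∃; _×_; _,_)
open import Relation.Binary.PropositionalEquality using (_≡_; _≢_)
open import Relation.Unary using (Pred; _⊆_)
open import Level using (0ℓ)

State : ℕ → Set
State n = Vec Bool n

BN : ℕ → Set
BN n = State n → State n

flip : ∀ {n} → State n → Fin n → State n
flip x i = x [ i ]≔ not (lookup x i)

set : ∀ {n} → State n → Fin n → Bool → State n
set x i a = x [ i ]≔ a

b2z : Bool → ℤ
b2z false = ℤ.0ℤ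
b2z true  = ℤ.1ℤ

Trans : ∀ {n} → BN n → State n → State n → Set
Trans f x y = ∃ λ i → (lookup (f x) i ≢ lookup x i) × (y ≡ flip x i)

StateSet : ℕ → Set₁
StateSet n = Pred (State n) 0ℓ

_≐_ : ∀ {n} → StateSet n → StateSet n → Set
A ≐ B = (A ⊆ B) × (B ⊆ A)

IsTrapSet : ∀ {n} → BN n → StateSet n → Set
IsTrapSet f T = ∀ x y → T x → Trans f x y → T y

NonEmpty : ∀ {n} → StateSet n → Set
NonEmpty T = ∃ λ x → T x

IsAttractor : ∀ {n} → BN n → StateSet n → Set₁
IsAttractor f A =
  NonEmpty A × IsTrapSet f A ×
  (∀ (T : StateSet _) → NonEmpty T → IsTrapSet f T → T ⊆ A → A ⊆ T)

Edge : ∀ {n} → BN n → Fin n → Fin n → Sign → Set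
Edge f j i s = ∃ λ x →
  (s ◃ 1) ≡ (b2z (lookup (f (flip x j)) i) ℤ.- b2z (lookup (f x) i))
              ℤ.* (b2z (lookup (flip x j) j) ℤ.- b2z (lookup x j))

proj : ∀ {m} → Fin (suc m) → State (suc m) → State m
proj v x = removeAt x v

S : ∀ {m} → BN (suc m) → Fin (suc m) → Bool → State m → State (suc m)
S f v a y = insertAt y v (lookup (f (insertAt y v a)) v)

-- Component i of the reduced network corresponds to component punchIn v i of f
reduce : ∀ {m} → BN (suc m) → Fin (suc m) → BN m
reduce f v y = Data.Vec.tabulate λ i →
  if lookup y i
  then lookup (f (S f v false y)) (punchIn v i) ∧ lookup (f (S f v true y)) (punchIn v i)
  else lookup (f (S f v false y)) (punchIn v i) ∨ lookup (f (S f v true y)) (punchIn v i)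

image : ∀ {m} → Fin (suc m) → StateSet (suc m) → StateSet m
image v A y = ∃ λ x → A x × proj v x ≡ y

-- Partition labels: V = U₁ ⊔ U₂ ⊔ W ⊔ {v}
data Part : Set where
  U₁ U₂ W V : Part

data Allowed : Part → Part → Sign → Set where
  u1u1 : ∀ {s} → Allowed U₁ U₁ s
  u2u2 : ∀ {s} → Allowed U₂ U₂ s
  ww   : ∀ {s} → Allowed W W s
  u1u2 : ∀ {s} → Allowed U₁ U₂ s
  u1w  : ∀ {s} → Allowed U₁ W s
  u2v  : ∀ {s} → Allowed U₂ V s
  vw   : ∀ {s} → Allowed V W s
  vv   : Allowed V V Sign.-

-- The upstream components U₁ ∪ U₂ evolve autonomously, and f̃ agrees with f on them, so
-- upstream transitions of f project to transitions of f̃. Every transition of f̃ lifts to a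
-- run of f that first updates v, which uses that v has no positive loop. Conversely, a
-- W-transition of f need not project, since the value of v may be one that f̃ does not
-- consider for the current values of U₂. Along an attractor this is harmless: U₂ alone
-- can be advanced, changing nothing W reads, until v is coherent; there the W-transition
-- projects, and recurrence of the upstream dynamics leads back. This property is preserved
-- by all transitions, so runs inside attractors project to runs of f̃; as attractors are
-- the reachability sets of recurrent states, the attractors of f and f̃ then correspond.

module Submission where

open import Defs
open import Data.Nat using (ℕ; suc)
open import Data.Fin using (Fin; punchIn; punchOut; _≟_)
open import Data.Fin.Properties using (punchInᵢ≢i; punchIn-punchOut; punchOut-punchIn; punchIn-injective)
open import Data.Bool using (Bool; true; false; not; _∧_; _∨_; if_then_else_)
open import Data.Bool.Properties using (not-involutive; ¬-not; not-¬) renaming (_≟_ to _≟ᵇ_)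
open import Data.Vec using (lookup; _[_]≔_; insertAt; removeAt; tabulate)
open import Data.Vec.Properties
  using (lookup∘update; lookup∘update′; []≔-idempotent; []≔-commutes; []≔-lookup;
         tabulate∘lookup; tabulate-cong; lookup∘tabulate;
         removeAt-punchOut; removeAt-insertAt; insertAt-removeAt)
open import Data.List using (List; []; _∷_; allFin)
open import Data.List.Membership.Propositional using (_∈_)
open import Data.List.Membership.Propositional.Properties using (∈-allFin)
open import Data.List.Relation.Unary.Any using (here; there)
open import Data.Integer as ℤ using (_◃_)
open import Data.Sign using (Sign)
open import Data.Product using (Σ; ∃; _×_; _,_; proj₁; proj₂)
open import Data.Sum using (_⊎_; inj₁; inj₂) renaming (map to ⊎-map)
open import Data.Empty using (⊥; ⊥-elim)
open import Function.Bundles using (_⇔_; mk⇔; Equivalence)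
open import Relation.Nullary using (¬_; yes; no; Dec)
open import Relation.Unary using (_⊆_)
open import Relation.Binary.PropositionalEquality
open import Relation.Binary.Construct.Closure.ReflexiveTransitive using (Star; ε; _◅_; _◅◅_)

module _ {n : ℕ} where

  AgreeOn : (Fin n → Set) → State n → State n → Set
  AgreeOn P x y = ∀ j → P j → lookup x j ≡ lookup y j

  lookup-ext : {x y : State n} → (∀ j → lookup x j ≡ lookup y j) → x ≡ y
  lookup-ext {x} {y} h = begin
    x                   ≡⟨ tabulate∘lookup x ⟨
    tabulate (lookup x) ≡⟨ tabulate-cong h ⟩
    tabulate (lookup y) ≡⟨ tabulate∘lookup y ⟩
    y                   ∎
    where open ≡-Reasoning

  lookup-flip-≡ : ∀ (x : State n) i → lookup (flip x i) i ≡ not (lookup x i)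
  lookup-flip-≡ x i = lookup∘update i x _

  lookup-flip-≢ : ∀ (x : State n) {i j} → i ≢ j → lookup (flip x i) j ≡ lookup x j
  lookup-flip-≢ x i≢j = lookup∘update′ (≢-sym i≢j) x _

  flip-involutive : ∀ (x : State n) i → flip (flip x i) i ≡ x
  flip-involutive x i = begin
    flip (flip x i) i                       ≡⟨ []≔-idempotent x i ⟩
    x [ i ]≔ not (lookup (flip x i) i)      ≡⟨ cong (λ b → x [ i ]≔ not b) (lookup-flip-≡ x i) ⟩
    x [ i ]≔ not (not (lookup x i))         ≡⟨ cong (x [ i ]≔_) (not-involutive _) ⟩
    x [ i ]≔ lookup x i                     ≡⟨ []≔-lookup x i ⟩
    x                                       ∎
    where open ≡-Reasoning

  flip-comm : ∀ (x : State n) {i k} → i ≢ k → flip (flip x i) k ≡ flip (flip x k) i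
  flip-comm x {i} {k} i≢k = begin
    flip (flip x i) k
      ≡⟨ cong (λ b → flip x i [ k ]≔ not b) (lookup-flip-≢ x i≢k) ⟩
    (x [ i ]≔ not (lookup x i)) [ k ]≔ not (lookup x k)
      ≡⟨ []≔-commutes x i k i≢k ⟩
    (x [ k ]≔ not (lookup x k)) [ i ]≔ not (lookup x i)
      ≡⟨ cong (λ b → flip x k [ i ]≔ not b) (lookup-flip-≢ x (≢-sym i≢k)) ⟨
    flip (flip x k) i
      ∎
    where open ≡-Reasoning

  set≡id⊎flip : ∀ (x : State n) i b → set x i b ≡ x ⊎ set x i b ≡ flip x i
  set≡id⊎flip x i b with b ≟ᵇ lookup x i
  ... | yes refl = inj₁ ([]≔-lookup x i)
  ... | no b≢xᵢ  = inj₂ (cong (x [ i ]≔_) (¬-not b≢xᵢ))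

  flip-preserves-agreement : ∀ {P} {x y : State n} i → AgreeOn P x y → AgreeOn P (flip x i) (flip y i)
  flip-preserves-agreement {x = x} {y} i agree j Pj with i ≟ j
  ... | yes refl = trans (lookup-flip-≡ x i) (trans (cong not (agree i Pj)) (sym (lookup-flip-≡ y i)))
  ... | no i≢j   = trans (lookup-flip-≢ x i≢j) (trans (agree j Pj) (sym (lookup-flip-≢ y i≢j)))

  Insensitive : (State n → Bool) → Fin n → Set
  Insensitive h j = ∀ x → h (flip x j) ≡ h x

  insensitive-to-listed-differences : ∀ (h : State n → Bool) (L : List (Fin n)) {x y : State n} →
    (∀ j → lookup x j ≢ lookup y j → j ∈ L × Insensitive h j) → h x ≡ h y
  insensitive-to-listed-differences h [] {x} {y} diff = cong h (lookup-ext agree)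
    where
    agree : ∀ j → lookup x j ≡ lookup y j
    agree j with lookup x j ≟ᵇ lookup y j
    ... | yes xⱼ≡yⱼ = xⱼ≡yⱼ
    ... | no xⱼ≢yⱼ with () ← proj₁ (diff j xⱼ≢yⱼ)
  insensitive-to-listed-differences h (j ∷ L) {x} {y} diff =
    trans (sym h-unchanged) (insensitive-to-listed-differences h L diff′)
    where
    x′ = set x j (lookup y j)
    h-unchanged : h x′ ≡ h x
    h-unchanged with lookup x j ≟ᵇ lookup y j
    ... | yes xⱼ≡yⱼ = cong h (trans (cong (x [ j ]≔_) (sym xⱼ≡yⱼ)) ([]≔-lookup x j))
    ... | no xⱼ≢yⱼ  = trans (cong (λ b → h (x [ j ]≔ b)) (¬-not (≢-sym xⱼ≢yⱼ))) (proj₂ (diff j xⱼ≢yⱼ) x)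
    diff′ : ∀ j′ → lookup x′ j′ ≢ lookup y j′ → j′ ∈ L × Insensitive h j′
    diff′ j′ x′≢y with j ≟ j′
    ... | yes refl = ⊥-elim (x′≢y (lookup∘update j x _))
    ... | no j≢j′ with diff j′ (λ xⱼ′≡yⱼ′ → x′≢y (trans (lookup∘update′ (≢-sym j≢j′) x _) xⱼ′≡yⱼ′))
    ...   | here refl , _   = ⊥-elim (j≢j′ refl)
    ...   | there j′∈L , ins = j′∈L , ins

  insensitive-to-differences : ∀ (h : State n → Bool) {x y : State n} →
    (∀ j → lookup x j ≢ lookup y j → Insensitive h j) → h x ≡ h y
  insensitive-to-differences h ins =
    insensitive-to-listed-differences h (allFin _) (λ j xⱼ≢yⱼ → ∈-allFin j , ins j xⱼ≢yⱼ)

module _ {n : ℕ} where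

  ≐-refl : {A : StateSet n} → A ≐ A
  ≐-refl = (λ Ax → Ax) , (λ Ax → Ax)

  ≐-sym : {A B : StateSet n} → A ≐ B → B ≐ A
  ≐-sym (A⊆B , B⊆A) = B⊆A , A⊆B

  ≐-trans : {A B C : StateSet n} → A ≐ B → B ≐ C → A ≐ C
  ≐-trans (A⊆B , B⊆A) (B⊆C , C⊆B) = (λ Ax → B⊆C (A⊆B Ax)) , (λ Cx → B⊆A (C⊆B Cx))

sign-of-change : ∀ p q {r r′} → p ≢ q → r′ ≡ not r →
                 ∃ λ s → (s ◃ 1) ≡ (b2z p ℤ.- b2z q) ℤ.* (b2z r′ ℤ.- b2z r)
sign-of-change true  true          p≢q _    = ⊥-elim (p≢q refl)
sign-of-change false false         p≢q _    = ⊥-elim (p≢q refl)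
sign-of-change true  false {true}  _   refl = Sign.- , refl
sign-of-change true  false {false} _   refl = Sign.+ , refl
sign-of-change false true  {true}  _   refl = Sign.+ , refl
sign-of-change false true  {false} _   refl = Sign.- , refl

change-squared : ∀ {r r′} → r′ ≡ not r → (Sign.+ ◃ 1) ≡ (b2z r′ ℤ.- b2z r) ℤ.* (b2z r′ ℤ.- b2z r)
change-squared {true}  refl = refl
change-squared {false} refl = refl

module _ {n : ℕ} (f : BN n) where

  sensitive⇒edge : ∀ {j i} x → lookup (f (flip x j)) i ≢ lookup (f x) i → ∃ λ s → Edge f j i s
  sensitive⇒edge {j} x changes =
    let s , sign = sign-of-change _ _ changes (lookup-flip-≡ x j) in s , x , sign

  fixed-on-both-sides⇒positive-loop : ∀ x j → lookup (f x) j ≡ lookup x j →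
    lookup (f (flip x j)) j ≡ lookup (flip x j) j → Edge f j j Sign.+
  fixed-on-both-sides⇒positive-loop x j fixed flip-fixed = x , sign
    where
    sign : (Sign.+ ◃ 1) ≡ (b2z (lookup (f (flip x j)) j) ℤ.- b2z (lookup (f x) j))
                          ℤ.* (b2z (lookup (flip x j) j) ℤ.- b2z (lookup x j))
    sign rewrite fixed | flip-fixed = change-squared (lookup-flip-≡ x j)

  Reach : State n → StateSet n
  Reach = Star (Trans f)

  Recurrent : State n → Set
  Recurrent x = ∀ y → Reach x y → Reach y x

  trap-closed : ∀ {T : StateSet n} → IsTrapSet f T → ∀ {x} → T x → Reach x ⊆ T
  trap-closed trap Tx ε             = Tx
  trap-closed trap Tx (step ◅ path) = trap-closed trap (trap _ _ Tx step) path

  Reach-isTrapSet : ∀ x → IsTrapSet f (Reach x)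
  Reach-isTrapSet x y z x⇝y y→z = x⇝y ◅◅ (y→z ◅ ε)

  attractor⊆Reach : ∀ {A} → IsAttractor f A → ∀ {x} → A x → A ⊆ Reach x
  attractor⊆Reach (_ , trap , minimal) Ax =
    minimal (Reach _) (_ , ε) (Reach-isTrapSet _) (trap-closed trap Ax)

  attractor≐Reach : ∀ {A} → IsAttractor f A → ∀ {x} → A x → A ≐ Reach x
  attractor≐Reach attractor Ax = attractor⊆Reach attractor Ax , trap-closed (proj₁ (proj₂ attractor)) Ax

  attractor⇒recurrent : ∀ {A} → IsAttractor f A → ∀ {x} → A x → Recurrent x
  attractor⇒recurrent attractor Ax y x⇝y =
    attractor⊆Reach attractor (proj₂ (attractor≐Reach attractor Ax) x⇝y) Ax

  recurrent⇒attractor : ∀ {x} → Recurrent x → IsAttractor f (Reach x)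
  recurrent⇒attractor {x} recurrent = (x , ε) , Reach-isTrapSet x , minimal
    where
    minimal : ∀ T → NonEmpty T → IsTrapSet f T → T ⊆ Reach x → Reach x ⊆ T
    minimal T (t , Tt) trap T⊆Rx x⇝y = trap-closed trap Tt (recurrent t (T⊆Rx Tt) ◅◅ x⇝y)

  attractor-resp-≐ : ∀ {A B} → A ≐ B → IsAttractor f B → IsAttractor f A
  attractor-resp-≐ (A⊆B , B⊆A) ((x , Bx) , trap , minimal) =
    (x , B⊆A Bx) , (λ x y Ax step → B⊆A (trap x y (A⊆B Ax) step)) ,
    (λ T nonEmpty trapT T⊆A Ax → minimal T nonEmpty trapT (λ Tx → A⊆B (T⊆A Tx)) (A⊆B Ax))

merge : Bool → Bool → Bool → Bool
merge b p q = if b then p ∧ q else p ∨ q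

merge-idem : ∀ b p → merge b p p ≡ p
merge-idem true  true  = refl
merge-idem true  false = refl
merge-idem false true  = refl
merge-idem false false = refl

merge-moves : ∀ b p q → merge b p q ≢ b ⇔ (p ≢ b ⊎ q ≢ b)
merge-moves b p q = mk⇔ (to b p q) (from b p q)
  where
  to : ∀ b p q → merge b p q ≢ b → p ≢ b ⊎ q ≢ b
  to b p q moves with p ≟ᵇ b | q ≟ᵇ b
  ... | no p≢b   | _        = inj₁ p≢b
  ... | yes _    | no q≢b   = inj₂ q≢b
  ... | yes refl | yes refl = ⊥-elim (moves (merge-idem p p))
  from : ∀ b p q → p ≢ b ⊎ q ≢ b → merge b p q ≢ b
  from true  false q     _          ()
  from true  true  false _          ()
  from true  true  true  (inj₁ p≢b) _ = p≢b refl
  from true  true  true  (inj₂ q≢b) _ = q≢b refl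
  from false true  q     _          ()
  from false false true  _          ()
  from false false false (inj₁ p≢b) _ = p≢b refl
  from false false false (inj₂ q≢b) _ = q≢b refl

module Projection {m : ℕ} (v : Fin (suc m)) where

  π : State (suc m) → State m
  π = proj v

  punchIn-elim : ∀ {P : Fin (suc m) → Set} → (∀ k → P (punchIn v k)) → ∀ i → v ≢ i → P i
  punchIn-elim {P} h i v≢i = subst P (punchIn-punchOut v≢i) (h (punchOut v≢i))

  lookup-π : ∀ x k → lookup (π x) k ≡ lookup x (punchIn v k)
  lookup-π x k = trans (cong (lookup (π x)) (sym (punchOut-punchIn v)))
                       (removeAt-punchOut x (≢-sym (punchInᵢ≢i v k)))

  π-≡⇒agree : ∀ {x y} → π x ≡ π y → AgreeOn (v ≢_) x y
  π-≡⇒agree {x} {y} πx≡πy = punchIn-elim (λ k →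
    trans (sym (lookup-π x k)) (trans (cong (λ z → lookup z k) πx≡πy) (lookup-π y k)))

  π-flip : ∀ x k → π (flip x (punchIn v k)) ≡ flip (π x) k
  π-flip x k = lookup-ext lookups
    where
    lookups : ∀ k′ → lookup (π (flip x (punchIn v k))) k′ ≡ lookup (flip (π x) k) k′
    lookups k′ with k ≟ k′
    ... | yes refl = trans (lookup-π (flip x (punchIn v k)) k) (trans (lookup-flip-≡ x _)
                       (trans (cong not (sym (lookup-π x k))) (sym (lookup-flip-≡ (π x) k))))
    ... | no k≢k′  = trans (lookup-π (flip x (punchIn v k)) k′)
                       (trans (lookup-flip-≢ x (λ e → k≢k′ (punchIn-injective v k k′ e)))
                       (trans (sym (lookup-π x k′)) (sym (lookup-flip-≢ (π x) k≢k′))))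

  π-set : ∀ x b → π (set x v b) ≡ π x
  π-set x b = lookup-ext λ k →
    trans (lookup-π (set x v b) k) (trans (lookup∘update′ (punchInᵢ≢i v k) x b) (sym (lookup-π x k)))

  insertAt-π : ∀ x b → insertAt (π x) v b ≡ set x v b
  insertAt-π x b = begin
    insertAt (π x) v b                                 ≡⟨ cong (λ y → insertAt y v b) (π-set x b) ⟨
    insertAt (π (set x v b)) v b                       ≡⟨ cong (insertAt _ v) (lookup∘update v x b) ⟨
    insertAt (π (set x v b)) v (lookup (set x v b) v)  ≡⟨ insertAt-removeAt (set x v b) v ⟩
    set x v b                                          ∎
    where open ≡-Reasoning

  π-fibre : ∀ {x y} → π x ≡ π y → x ≡ y ⊎ x ≡ flip y v
  π-fibre {x} {y} πx≡πy =
    ⊎-map (trans (sym y-reset)) (trans (sym y-reset)) (set≡id⊎flip y v (lookup x v))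
    where
    open ≡-Reasoning
    y-reset : set y v (lookup x v) ≡ x
    y-reset = begin
      set y v (lookup x v)           ≡⟨ insertAt-π y _ ⟨
      insertAt (π y) v (lookup x v)  ≡⟨ cong (λ z → insertAt z v (lookup x v)) πx≡πy ⟨
      insertAt (π x) v (lookup x v)  ≡⟨ insertAt-removeAt x v ⟩
      x                              ∎

module Lifting {m : ℕ} (f : BN (suc m)) (v : Fin (suc m)) (no-positive-loop : ¬ Edge f v v Sign.+) where

  open Projection v public

  f̃ : BN m
  f̃ = reduce f v

  f[_] : Fin (suc m) → State (suc m) → Bool
  f[ i ] x = lookup (f x) i

  fᵥ : State (suc m) → Bool
  fᵥ = f[ v ]

  lookup-reduce : ∀ y k → lookup (f̃ y) k ≡
    merge (lookup y k) (f[ punchIn v k ] (S f v false y)) (f[ punchIn v k ] (S f v true y))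
  lookup-reduce y k = lookup∘tabulate _ k

  S-π : ∀ a x → S f v a (π x) ≡ set x v (fᵥ (set x v a))
  S-π a x = trans (cong (λ y → insertAt (π x) v (fᵥ y)) (insertAt-π x a)) (insertAt-π x _)

  reach-S : ∀ a x → Reach f x (set x v (fᵥ (set x v a)))
  reach-S a x with fᵥ (set x v a) ≟ᵇ lookup x v
  ... | yes b≡xᵥ = subst (Reach f x) (sym (trans (cong (set x v) b≡xᵥ) ([]≔-lookup x v))) ε
  ... | no b≢xᵥ  = subst (Reach f x) (sym (cong (set x v) (¬-not b≢xᵥ))) ((v , moves , refl) ◅ ε)
    where
    moves : fᵥ x ≢ lookup x v
    moves fixed with set≡id⊎flip x v a
    ... | inj₁ unchanged = b≢xᵥ (trans (cong fᵥ unchanged) fixed)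
    ... | inj₂ flipped   = no-positive-loop (fixed-on-both-sides⇒positive-loop f x v fixed
            (trans (cong fᵥ (sym flipped)) (trans (¬-not b≢xᵥ) (sym (lookup-flip-≡ x v)))))

  lift-via-S : ∀ a x k → f[ punchIn v k ] (S f v a (π x)) ≢ lookup (π x) k →
               Σ (State (suc m)) λ x′ → Reach f x x′ × π x′ ≡ flip (π x) k
  lift-via-S a x k moves = flip xₐ i , reach-S a x ◅◅ ((i , movesₐ , refl) ◅ ε) , π-flip-xₐ
    where
    i  = punchIn v k
    xₐ = set x v (fᵥ (set x v a))
    movesₐ : f[ i ] xₐ ≢ lookup xₐ i
    movesₐ e = moves (trans (cong f[ i ] (S-π a x))
                       (trans e (trans (lookup∘update′ (punchInᵢ≢i v k) x _) (sym (lookup-π x k)))))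
    π-flip-xₐ : π (flip xₐ i) ≡ flip (π x) k
    π-flip-xₐ = trans (π-flip xₐ k) (cong (λ z → flip z k) (π-set x _))

  lift-step : ∀ x {y} → Trans f̃ (π x) y → Σ (State (suc m)) λ x′ → Reach f x x′ × π x′ ≡ y
  lift-step x (k , moves , refl)
    with Equivalence.to (merge-moves _ _ _) (λ e → moves (trans (lookup-reduce (π x) k) e))
  ... | inj₁ moves₀ = lift-via-S false x k moves₀
  ... | inj₂ moves₁ = lift-via-S true  x k moves₁

  lift : ∀ {y₀ y} → Reach f̃ y₀ y → ∀ x → π x ≡ y₀ →
         Σ (State (suc m)) λ x′ → Reach f x x′ × π x′ ≡ y
  lift ε             x πx≡y₀ = x , ε , πx≡y₀
  lift (step ◅ path) x refl with lift-step x step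
  ... | x₁ , x⇝x₁ , πx₁≡y₁ with lift path x₁ πx₁≡y₁
  ...   | x₂ , x₁⇝x₂ , πx₂≡y = x₂ , x⇝x₁ ◅◅ x₁⇝x₂ , πx₂≡y

  -- Equivalently x = Sᵃ (π x) for some a; then its transitions outside v are transitions of f̃.
  Coherent : State (suc m) → Set
  Coherent x = lookup x v ≡ fᵥ x ⊎ lookup x v ≡ fᵥ (flip x v)

  coherent⇒S-fixed : ∀ {x} → Coherent x → ∃ λ a → S f v a (π x) ≡ x
  coherent⇒S-fixed {x} (inj₁ xᵥ≡fᵥx) = lookup x v , (begin
    S f v (lookup x v) (π x)                       ≡⟨ S-π _ x ⟩
    set x v (fᵥ (set x v (lookup x v)))            ≡⟨ cong (λ z → set x v (fᵥ z)) ([]≔-lookup x v) ⟩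
    set x v (fᵥ x)                                 ≡⟨ cong (set x v) xᵥ≡fᵥx ⟨
    set x v (lookup x v)                           ≡⟨ []≔-lookup x v ⟩
    x                                              ∎)
    where open ≡-Reasoning
  coherent⇒S-fixed {x} (inj₂ xᵥ≡fᵥx̄) = not (lookup x v) , (begin
    S f v (not (lookup x v)) (π x)                 ≡⟨ S-π _ x ⟩
    set x v (fᵥ (flip x v))                        ≡⟨ cong (set x v) xᵥ≡fᵥx̄ ⟨
    set x v (lookup x v)                           ≡⟨ []≔-lookup x v ⟩
    x                                              ∎)
    where open ≡-Reasoning

  flipᵥ-coherent : ∀ x → fᵥ x ≢ lookup x v → Coherent (flip x v)
  flipᵥ-coherent x moves = inj₂ (begin
    lookup (flip x v) v   ≡⟨ lookup-flip-≡ x v ⟩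
    not (lookup x v)      ≡⟨ ¬-not moves ⟨
    fᵥ x                  ≡⟨ cong fᵥ (flip-involutive x v) ⟨
    fᵥ (flip (flip x v) v) ∎)
    where open ≡-Reasoning

  reach-coherent : ∀ x → Σ (State (suc m)) λ x′ → Reach f x x′ × Coherent x′ × π x′ ≡ π x
  reach-coherent x with lookup x v ≟ᵇ fᵥ x
  ... | yes fixed = x , ε , inj₁ fixed , refl
  ... | no moves  = flip x v , (v , ≢-sym moves , refl) ◅ ε , flipᵥ-coherent x (≢-sym moves) , π-set x _

  reach-coherent-in-fibre : ∀ {x x₀} → Coherent x₀ → π x ≡ π x₀ → Reach f x x₀
  reach-coherent-in-fibre {x} {x₀} coherent πx≡πx₀ with π-fibre {x} {x₀} πx≡πx₀
  ... | inj₁ refl = ε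
  ... | inj₂ refl = (v , moves coherent , sym (flip-involutive x₀ v)) ◅ ε
    where
    moves : Coherent x₀ → fᵥ (flip x₀ v) ≢ lookup (flip x₀ v) v
    moves (inj₁ fixed) flip-fixed =
      no-positive-loop (fixed-on-both-sides⇒positive-loop f x₀ v (sym fixed) flip-fixed)
    moves (inj₂ x₀ᵥ≡fᵥx̄₀) flip-fixed =
      not-¬ refl (trans x₀ᵥ≡fᵥx̄₀ (trans flip-fixed (lookup-flip-≡ x₀ v)))

  coherent-over : ∀ y → Σ (State (suc m)) λ x → Coherent x × π x ≡ y
  coherent-over y with reach-coherent (insertAt y v false)
  ... | x , _ , coherent , πx≡ = x , coherent , trans πx≡ (removeAt-insertAt y v false)

  reach-over-coherent : ∀ {x x₀} → Coherent x₀ → Reach f̃ (π x) (π x₀) → Reach f x x₀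
  reach-over-coherent {x} coherent path with lift path x refl
  ... | x′ , x⇝x′ , πx′≡πx₀ = x⇝x′ ◅◅ reach-coherent-in-fibre coherent πx′≡πx₀

  project-coherent-step : ∀ {z i} → Coherent z → v ≢ i → f[ i ] z ≢ lookup z i →
                          Trans f̃ (π z) (π (flip z i))
  project-coherent-step {z} {i} coherent =
    punchIn-elim {λ i → f[ i ] z ≢ lookup z i → Trans f̃ (π z) (π (flip z i))} at-punchIn i
    where
    at-punchIn : ∀ k → f[ punchIn v k ] z ≢ lookup z (punchIn v k) →
                 Trans f̃ (π z) (π (flip z (punchIn v k)))
    at-punchIn k moves = k , reduced-moves , π-flip z k
      where
      fₖ = f[ punchIn v k ]
      moves-at : ∀ {a} → S f v a (π z) ≡ z → fₖ (S f v a (π z)) ≢ lookup (π z) k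
      moves-at Sₐ≡z e = moves (trans (cong fₖ (sym Sₐ≡z)) (trans e (lookup-π z k)))
      candidate-moves : fₖ (S f v false (π z)) ≢ lookup (π z) k ⊎
                        fₖ (S f v true (π z)) ≢ lookup (π z) k
      candidate-moves with coherent⇒S-fixed coherent
      ... | false , S₀≡z = inj₁ (moves-at S₀≡z)
      ... | true  , S₁≡z = inj₂ (moves-at S₁≡z)
      reduced-moves : lookup (f̃ (π z)) k ≢ lookup (π z) k
      reduced-moves e =
        Equivalence.from (merge-moves _ _ _) candidate-moves (trans (sym (lookup-reduce (π z) k)) e)

data Upstream : Part → Set where
  in-U₁ : Upstream U₁
  in-U₂ : Upstream U₂

upstream? : ∀ p → Dec (Upstream p)
upstream? U₁ = yes in-U₁
upstream? U₂ = yes in-U₂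
upstream? W  = no λ ()
upstream? V  = no λ ()

data U₁∪W : Part → Set where
  in-U₁ : U₁∪W U₁
  in-W  : U₁∪W W

¬Allowed-downstream→upstream : ∀ {p q s} → Upstream q → ¬ Upstream p → ¬ Allowed p q s
¬Allowed-downstream→upstream in-U₁ ¬up u1u1 = ¬up in-U₁
¬Allowed-downstream→upstream in-U₂ ¬up u2u2 = ¬up in-U₂
¬Allowed-downstream→upstream in-U₂ ¬up u1u2 = ¬up in-U₁

¬Allowed-U₁∪W→V : ∀ {p s} → U₁∪W p → ¬ Allowed p V s
¬Allowed-U₁∪W→V in-U₁ ()
¬Allowed-U₁∪W→V in-W  ()

¬Allowed-U₂→U₁∪W : ∀ {q s} → U₁∪W q → ¬ Allowed U₂ q s
¬Allowed-U₂→U₁∪W in-U₁ ()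
¬Allowed-U₂→U₁∪W in-W  ()

Upstream⇒≢V : ∀ {p} → Upstream p → p ≢ V
Upstream⇒≢V in-U₁ ()
Upstream⇒≢V in-U₂ ()

U₁∪W⇒≢V : ∀ {p} → U₁∪W p → p ≢ V
U₁∪W⇒≢V in-U₁ ()
U₁∪W⇒≢V in-W  ()

U₁∪W⇒≢U₂ : ∀ {p} → U₁∪W p → p ≢ U₂
U₁∪W⇒≢U₂ in-U₁ ()
U₁∪W⇒≢U₂ in-W  ()

U₂-stable : ∀ {p} → ¬ p ≢ U₂ → p ≡ U₂
U₂-stable {U₁} ¬≢U₂ = ⊥-elim (¬≢U₂ λ ())
U₂-stable {U₂} _    = refl
U₂-stable {W}  ¬≢U₂ = ⊥-elim (¬≢U₂ λ ())
U₂-stable {V}  ¬≢U₂ = ⊥-elim (¬≢U₂ λ ())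

module Elimination {m : ℕ} (f : BN (suc m)) (v : Fin (suc m)) (part : Fin (suc m) → Part)
  (part≡V⇔v : ∀ i → (part i ≡ V) ⇔ (i ≡ v))
  (allowed : ∀ j i s → Edge f j i s → Allowed (part j) (part i) s) where

  part-v : part v ≡ V
  part-v = Equivalence.from (part≡V⇔v v) refl

  ≢V⇒v≢ : ∀ {i} → part i ≢ V → v ≢ i
  ≢V⇒v≢ {i} part≢V v≡i = part≢V (Equivalence.from (part≡V⇔v i) (sym v≡i))

  no-positive-loop : ¬ Edge f v v Sign.+
  no-positive-loop edge =
    ¬Allowed-V→V⁺ (subst (λ p → Allowed p p Sign.+) part-v (allowed v v Sign.+ edge))
    where
    ¬Allowed-V→V⁺ : ¬ Allowed V V Sign.+
    ¬Allowed-V→V⁺ ()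

  open Lifting f v no-positive-loop public

  Up Down NotU₂ : Fin (suc m) → Set
  Up i    = Upstream (part i)
  Down i  = ¬ Up i
  NotU₂ i = part i ≢ U₂

  up⇒v≢ : ∀ {i} → Up i → v ≢ i
  up⇒v≢ up = ≢V⇒v≢ (Upstream⇒≢V up)

  U₁∪W⇒v≢ : ∀ {i} → U₁∪W (part i) → v ≢ i
  U₁∪W⇒v≢ i∈U₁∪W = ≢V⇒v≢ (U₁∪W⇒≢V i∈U₁∪W)

  v-down : Down v
  v-down up = up⇒v≢ up refl

  up≢down : ∀ {i j} → Up i → Down j → i ≢ j
  up≢down up down refl = down up

  insensitive : ∀ {j i} → (∀ {s} → ¬ Allowed (part j) (part i) s) → Insensitive f[ i ] j
  insensitive {j} {i} ¬allowed x with f[ i ] (flip x j) ≟ᵇ f[ i ] x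
  ... | yes same   = same
  ... | no changes = ⊥-elim (¬allowed (allowed j i _ (proj₂ (sensitive⇒edge f x changes))))

  upstream-ignores-downstream : ∀ {i k} → Up i → Down k → Insensitive f[ i ] k
  upstream-ignores-downstream up down = insensitive (¬Allowed-downstream→upstream up down)

  upstream-determined : ∀ {i x y} → Up i → AgreeOn Up x y → f[ i ] x ≡ f[ i ] y
  upstream-determined up agree = insensitive-to-differences _ λ j xⱼ≢yⱼ →
    upstream-ignores-downstream up (λ upⱼ → xⱼ≢yⱼ (agree j upⱼ))

  v-ignores-U₁∪W : ∀ {i} → U₁∪W (part i) → Insensitive fᵥ i
  v-ignores-U₁∪W {i} i∈U₁∪W =
    insensitive λ {s} a → ¬Allowed-U₁∪W→V i∈U₁∪W (subst (λ q → Allowed (part i) q s) part-v a)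

  U₁∪W-ignores-U₂ : ∀ {i x y} → U₁∪W (part i) → AgreeOn NotU₂ x y → f[ i ] x ≡ f[ i ] y
  U₁∪W-ignores-U₂ {i} i∈U₁∪W agree = insensitive-to-differences _ λ j xⱼ≢yⱼ →
    insensitive λ {s} a → ¬Allowed-U₂→U₁∪W i∈U₁∪W
      (subst (λ p → Allowed p (part i) s) (U₂-stable λ j∉U₂ → xⱼ≢yⱼ (agree j j∉U₂)) a)

  UStep : State (suc m) → State (suc m) → Set
  UStep x y = Σ (Fin (suc m)) λ i → Up i × f[ i ] x ≢ lookup x i × y ≡ flip x i

  UReach : State (suc m) → State (suc m) → Set
  UReach = Star UStep

  URecurrent : State (suc m) → Set
  URecurrent x = ∀ y → UReach x y → UReach y x

  UReach⇒Reach : ∀ {x y} → UReach x y → Reach f x y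
  UReach⇒Reach ε                              = ε
  UReach⇒Reach ((i , _ , moves , y≡) ◅ path) = (i , moves , y≡) ◅ UReach⇒Reach path

  UReach-keeps-downstream : ∀ {x y} → UReach x y → AgreeOn Down x y
  UReach-keeps-downstream ε j down = refl
  UReach-keeps-downstream {x} ((i , up , _ , refl) ◅ path) j down =
    trans (sym (lookup-flip-≢ x (up≢down up down))) (UReach-keeps-downstream path j down)

  UReach-flip-downstream : ∀ {k} → Down k → ∀ {x y} → UReach x y → UReach (flip x k) (flip y k)
  UReach-flip-downstream down ε = ε
  UReach-flip-downstream {k} down {x} ((i , up , moves , refl) ◅ path) =
    (i , up , moves′ , flip-comm x (up≢down up down)) ◅ UReach-flip-downstream down path
    where
    moves′ : f[ i ] (flip x k) ≢ lookup (flip x k) i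
    moves′ e = moves (trans (sym (upstream-ignores-downstream up down x))
                            (trans e (lookup-flip-≢ x (≢-sym (up≢down up down)))))

  UStep-transport : ∀ {x x′ y} → AgreeOn Up x x′ → UStep x y →
                    Σ (State (suc m)) λ y′ → UStep x′ y′ × AgreeOn Up y y′
  UStep-transport {x} {x′} agree (i , up , moves , refl) =
    flip x′ i , (i , up , moves′ , refl) , flip-preserves-agreement {x = x} {x′} i agree
    where
    moves′ : f[ i ] x′ ≢ lookup x′ i
    moves′ e = moves (trans (upstream-determined up agree) (trans e (sym (agree i up))))

  UReach-transport : ∀ {x x′ y} → AgreeOn Up x x′ → UReach x y →
                     Σ (State (suc m)) λ y′ → UReach x′ y′ × AgreeOn Up y y′
  UReach-transport {x′ = x′} agree ε = x′ , ε , agree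
  UReach-transport agree (step ◅ path) with UStep-transport agree step
  ... | y₁ , step′ , agree₁ with UReach-transport agree₁ path
  ...   | y₂ , path′ , agree₂ = y₂ , step′ ◅ path′ , agree₂

  upstream-shadow : ∀ {x y} → Reach f x y → Σ (State (suc m)) λ y′ → UReach x y′ × AgreeOn Up y′ y
  upstream-shadow {x} ε = x , ε , λ _ _ → refl
  upstream-shadow {x} ((i , moves , refl) ◅ path) with upstream-shadow path | upstream? (part i)
  ... | y′ , upath , agree | yes up = y′ , (i , up , moves , refl) ◅ upath , agree
  ... | y′ , upath , agree | no down
    with UReach-transport (λ j upⱼ → lookup-flip-≢ x (≢-sym (up≢down upⱼ down))) upath
  ...   | y″ , upath′ , agree′ = y″ , upath′ , λ j upⱼ → trans (sym (agree′ j upⱼ)) (agree j upⱼ)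

  UReach-from-Reach : ∀ {w x z} → Reach f w x → AgreeOn Up x z → AgreeOn Down w z → UReach w z
  UReach-from-Reach {w} {x} {z} path agreeUp agreeDown with upstream-shadow path
  ... | y , upath , agree = subst (UReach w) (lookup-ext y≗z) upath
    where
    y≗z : ∀ j → lookup y j ≡ lookup z j
    y≗z j with upstream? (part j)
    ... | yes up  = trans (agree j up) (agreeUp j up)
    ... | no down = trans (sym (UReach-keeps-downstream upath j down)) (agreeDown j down)

  URecurrent-step : ∀ {z z₁} → UStep z z₁ → URecurrent z → URecurrent z₁
  URecurrent-step step recurrent w path = recurrent w (step ◅ path) ◅◅ (step ◅ ε)

  URecurrent-flip-downstream : ∀ {z k} → Down k → URecurrent z → URecurrent (flip z k)
  URecurrent-flip-downstream {z} {k} down recurrent w path =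
    subst (λ t → UReach t (flip z k)) (flip-involutive w k)
      (UReach-flip-downstream down (recurrent (flip w k)
        (subst (λ t → UReach t (flip w k)) (flip-involutive z k) (UReach-flip-downstream down path))))

  recurrent⇒URecurrent : ∀ {x} → Recurrent f x → URecurrent x
  recurrent⇒URecurrent recurrent w path =
    UReach-from-Reach (recurrent w (UReach⇒Reach path)) (λ _ _ → refl)
                      (λ j down → sym (UReach-keeps-downstream path j down))

  upstream-ignores-v : ∀ {i} → Up i → ∀ x b → f[ i ] (set x v b) ≡ f[ i ] x
  upstream-ignores-v {i} up x b with set≡id⊎flip x v b
  ... | inj₁ unchanged = cong f[ i ] unchanged
  ... | inj₂ flipped   = trans (cong f[ i ] flipped) (upstream-ignores-downstream up v-down x)

  lookup-reduce-upstream : ∀ x k → Up (punchIn v k) → lookup (f̃ (π x)) k ≡ f[ punchIn v k ] x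
  lookup-reduce-upstream x k up = begin
    lookup (f̃ (π x)) k                                      ≡⟨ lookup-reduce (π x) k ⟩
    merge (lookup (π x) k) (fₖ (S f v false (π x))) (fₖ (S f v true (π x)))
                                                            ≡⟨ cong₂ (merge _) (S-ignored false) (S-ignored true) ⟩
    merge (lookup (π x) k) (fₖ x) (fₖ x)                    ≡⟨ merge-idem _ _ ⟩
    fₖ x                                                    ∎
    where
    open ≡-Reasoning
    fₖ = f[ punchIn v k ]
    S-ignored : ∀ a → fₖ (S f v a (π x)) ≡ fₖ x
    S-ignored a = trans (cong fₖ (S-π a x)) (upstream-ignores-v up x _)

  project-UStep : ∀ {x y} → UStep x y → Trans f̃ (π x) (π y)
  project-UStep {x} (i , up , moves , refl) =
    punchIn-elim {λ i → Up i → f[ i ] x ≢ lookup x i → Trans f̃ (π x) (π (flip x i))}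
                 at-punchIn i (up⇒v≢ up) up moves
    where
    at-punchIn : ∀ k → Up (punchIn v k) → f[ punchIn v k ] x ≢ lookup x (punchIn v k) →
                 Trans f̃ (π x) (π (flip x (punchIn v k)))
    at-punchIn k up moves =
      k , (λ e → moves (trans (sym (lookup-reduce-upstream x k up)) (trans e (lookup-π x k)))) , π-flip x k

  project-UReach : ∀ {x y} → UReach x y → Reach f̃ (π x) (π y)
  project-UReach ε             = ε
  project-UReach (step ◅ path) = project-UStep step ◅ project-UReach path

  f̃-recurrent⇒URecurrent : ∀ {z} → Recurrent f̃ (π z) → URecurrent z
  f̃-recurrent⇒URecurrent {z} recurrent w path with lift (recurrent (π w) (project-UReach path)) w refl
  ... | x , w⇝x , πx≡πz =
    UReach-from-Reach w⇝x (λ j up → π-≡⇒agree {x} {z} πx≡πz j (up⇒v≢ up))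
                          (λ j down → sym (UReach-keeps-downstream path j down))

  coherent-flip-U₁∪W : ∀ {z i} → U₁∪W (part i) → Coherent z → Coherent (flip z i)
  coherent-flip-U₁∪W {z} {i} i∈U₁∪W =
    ⊎-map (λ e → trans zᵥ-kept (trans e (sym (ignored z))))
          (λ e → trans zᵥ-kept (trans e (sym (trans (cong fᵥ (flip-comm z i≢v)) (ignored (flip z v))))))
    where
    ignored = v-ignores-U₁∪W i∈U₁∪W
    i≢v = ≢-sym (U₁∪W⇒v≢ i∈U₁∪W)
    zᵥ-kept : lookup (flip z i) v ≡ lookup z v
    zᵥ-kept = lookup-flip-≢ z i≢v

  -- The value of v in z may be outdated; advancing U₂ alone, which W does not read, repairs it.
  Tracked : State (suc m) → Set
  Tracked z = URecurrent z × Σ (State (suc m)) λ z′ → UReach z z′ × AgreeOn NotU₂ z z′ × Coherent z′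

  moves-in-witness : ∀ {z z′ i} → U₁∪W (part i) → AgreeOn NotU₂ z z′ →
                     f[ i ] z ≢ lookup z i → f[ i ] z′ ≢ lookup z′ i
  moves-in-witness {i = i} i∈U₁∪W agree moves e =
    moves (trans (U₁∪W-ignores-U₂ i∈U₁∪W agree) (trans e (sym (agree i (U₁∪W⇒≢U₂ i∈U₁∪W)))))

  tracked-step-U₁ : ∀ {z i} → part i ≡ U₁ → f[ i ] z ≢ lookup z i → Tracked z →
                    Tracked (flip z i) × Reach f̃ (π z) (π (flip z i))
  tracked-step-U₁ {z} {i} i∈U₁ moves (recurrent , z′ , path , agree , coherent) =
    (URecurrent-step step recurrent , flip z′ i ,
     recurrent (flip z i) (step ◅ ε) ◅◅ path ◅◅ (step′ ◅ ε) ,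
     flip-preserves-agreement {x = z} {z′} i agree , coherent-flip-U₁∪W i∈U₁∪W coherent) ,
    project-UStep step ◅ ε
    where
    up = subst Upstream (sym i∈U₁) in-U₁
    i∈U₁∪W = subst U₁∪W (sym i∈U₁) in-U₁
    step : UStep z (flip z i)
    step = i , up , moves , refl
    step′ : UStep z′ (flip z′ i)
    step′ = i , up , moves-in-witness i∈U₁∪W agree moves , refl

  tracked-step-U₂ : ∀ {z i} → part i ≡ U₂ → f[ i ] z ≢ lookup z i → Tracked z →
                    Tracked (flip z i) × Reach f̃ (π z) (π (flip z i))
  tracked-step-U₂ {z} {i} i∈U₂ moves (recurrent , z′ , path , agree , coherent) =
    (URecurrent-step step recurrent , z′ , recurrent (flip z i) (step ◅ ε) ◅◅ path , agree′ , coherent) ,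
    project-UStep step ◅ ε
    where
    step : UStep z (flip z i)
    step = i , subst Upstream (sym i∈U₂) in-U₂ , moves , refl
    agree′ : AgreeOn NotU₂ (flip z i) z′
    agree′ j j∉U₂ = trans (lookup-flip-≢ z λ { refl → j∉U₂ i∈U₂ }) (agree j j∉U₂)

  tracked-step-v : ∀ {z} → fᵥ z ≢ lookup z v → Tracked z →
                   Tracked (flip z v) × Reach f̃ (π z) (π (flip z v))
  tracked-step-v {z} moves (recurrent , _) =
    (URecurrent-flip-downstream v-down recurrent , flip z v , ε , (λ _ _ → refl) , flipᵥ-coherent z moves) ,
    subst (Reach f̃ (π z)) (sym (π-set z _)) ε

  tracked-step-W : ∀ {z i} → part i ≡ W → f[ i ] z ≢ lookup z i → Tracked z →
                   Tracked (flip z i) × Reach f̃ (π z) (π (flip z i))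
  tracked-step-W {z} {i} i∈W moves (recurrent , z′ , path , agree , coherent) =
    (URecurrent-flip-downstream down recurrent , flip z′ i , UReach-flip-downstream down path ,
     flip-preserves-agreement {x = z} {z′} i agree , coherent-flip-U₁∪W i∈U₁∪W coherent) ,
    project-UReach path ◅◅
    (project-coherent-step coherent (U₁∪W⇒v≢ i∈U₁∪W) (moves-in-witness i∈U₁∪W agree moves) ◅
     project-UReach (UReach-flip-downstream down (recurrent z′ path)))
    where
    down = subst (λ p → ¬ Upstream p) (sym i∈W) λ ()
    i∈U₁∪W = subst U₁∪W (sym i∈W) in-W

  tracked-step : ∀ {z w} → Tracked z → Trans f z w → Tracked w × Reach f̃ (π z) (π w)
  tracked-step tracked (i , moves , refl) with part i in i∈
  ... | U₁ = tracked-step-U₁ i∈ moves tracked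
  ... | U₂ = tracked-step-U₂ i∈ moves tracked
  ... | W  = tracked-step-W i∈ moves tracked
  ... | V with Equivalence.to (part≡V⇔v i) i∈
  ...   | refl = tracked-step-v moves tracked

  tracked-reach : ∀ {z w} → Tracked z → Reach f z w → Tracked w × Reach f̃ (π z) (π w)
  tracked-reach tracked ε = tracked , ε
  tracked-reach tracked (step ◅ path) with tracked-step tracked step
  ... | tracked₁ , path̃₁ with tracked-reach tracked₁ path
  ...   | tracked₂ , path̃₂ = tracked₂ , path̃₁ ◅◅ path̃₂

  tracked-init : ∀ {x} → URecurrent x → Coherent x → Tracked x
  tracked-init {x} recurrent coherent = recurrent , x , ε , (λ _ _ → refl) , coherent

  image-of-Reach : ∀ {A x₀} → Tracked x₀ → A ≐ Reach f x₀ → image v A ≐ Reach f̃ (π x₀)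
  image-of-Reach tracked (A⊆R , R⊆A) =
    (λ { (x , Ax , refl) → proj₂ (tracked-reach tracked (A⊆R Ax)) }) ,
    (λ path → let (x , x₀⇝x , πx≡y) = lift path _ refl in x , R⊆A x₀⇝x , πx≡y)

  tracked-recurrent : ∀ {x₀} → Tracked x₀ → Recurrent f x₀ → Recurrent f̃ (π x₀)
  tracked-recurrent {x₀} tracked recurrent y path with lift path x₀ refl
  ... | x , x₀⇝x , refl =
    proj₂ (tracked-reach (proj₁ (tracked-reach tracked x₀⇝x)) (recurrent x x₀⇝x))

  coherent-recurrent : ∀ {x₀} → Tracked x₀ → Coherent x₀ → Recurrent f̃ (π x₀) → Recurrent f x₀
  coherent-recurrent tracked coherent recurrent̃ w x₀⇝w =
    reach-over-coherent coherent (recurrent̃ (π w) (proj₂ (tracked-reach tracked x₀⇝w)))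

  attractor-projects : ∀ A → IsAttractor f A → IsAttractor f̃ (image v A)
  attractor-projects A attractor@((x , Ax) , trap , _) with reach-coherent x
  ... | x₀ , x⇝x₀ , coherent , _ =
    attractor-resp-≐ f̃ (image-of-Reach tracked (attractor≐Reach f attractor Ax₀))
                       (recurrent⇒attractor f̃ (tracked-recurrent tracked recurrent))
    where
    Ax₀ = trap-closed f trap Ax x⇝x₀
    recurrent = attractor⇒recurrent f attractor Ax₀
    tracked   = tracked-init (recurrent⇒URecurrent recurrent) coherent

  attractor-lifts : ∀ Ã → IsAttractor f̃ Ã →
    Σ (StateSet (suc m)) λ A → (IsAttractor f A × image v A ≐ Ã) ×
      (∀ A′ → IsAttractor f A′ → image v A′ ≐ Ã → A′ ≐ A)
  attractor-lifts Ã attractor̃@((y₀ , Ãy₀) , _) with coherent-over y₀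
  ... | x₀ , coherent , refl =
    Reach f x₀ ,
    (recurrent⇒attractor f recurrent , ≐-trans (image-of-Reach tracked ≐-refl) R̃≐Ã) ,
    unique
    where
    recurrent̃ = attractor⇒recurrent f̃ attractor̃ Ãy₀
    R̃≐Ã       = ≐-sym (attractor≐Reach f̃ attractor̃ Ãy₀)
    tracked   = tracked-init (f̃-recurrent⇒URecurrent recurrent̃) coherent
    recurrent = coherent-recurrent tracked coherent recurrent̃
    unique : ∀ A′ → IsAttractor f A′ → image v A′ ≐ Ã → A′ ≐ Reach f x₀
    unique A′ attractor′@((x₁ , A′x₁) , trap′ , _) (image⊆Ã , _) =
      attractor≐Reach f attractor′ (trap-closed f trap′ A′x₁ x₁⇝x₀)
      where
      x₁⇝x₀ = reach-over-coherent coherent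
                (recurrent̃ (π x₁) (proj₂ R̃≐Ã (image⊆Ã (x₁ , A′x₁ , refl))))

theorem4p5 : ∀ {m} (f : BN (suc m)) (v : Fin (suc m)) (part : Fin (suc m) → Part) →
    (∀ i → (part i ≡ V) ⇔ (i ≡ v)) →
    (∀ j i s → Edge f j i s → Allowed (part j) (part i) s) →
    (∃ λ j → ∃ λ s → part j ≡ U₂ × Edge f j v s) →
    (∃ λ i → ∃ λ s → part i ≡ W × Edge f v i s) →
    ((∀ (A : StateSet (suc m)) → IsAttractor f A →
        IsAttractor (reduce f v) (image v A))
     ×
     (∀ (Ã : StateSet m) → IsAttractor (reduce f v) Ã →
        Σ (StateSet (suc m)) λ A →
          (IsAttractor f A × image v A ≐ Ã) ×
          (∀ (A′ : StateSet (suc m)) → IsAttractor f A′ → image v A′ ≐ Ã → A′ ≐ A)))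
theorem4p5 f v part part≡V⇔v allowed _ _ = attractor-projects , attractor-lifts
  where open Elimination f v part part≡V⇔v allowed
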